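{- Let $G=(V,E)$ be a graph and let $S,X\subseteq V$ be such that both $G-S$ and $G-X$ are 2-plex cluster graphs. Let $M\subseteq V$ and let $H$ be the vertex set of a connected component of $G-X$ such that no vertex of $H\setminus M$ has a neighbor in $X$. If $|H\setminus M|\ge|H\cap M|+1$, then there exists $S'\subseteq V$ with $|S'|\le|S|$ such that $G-S'$ is a 2-plex cluster graph and $S'$ destroys all edges in $E(H,X)$.
   Context: All graphs are finite, simple and undirected. A 2-plex is a graph in which every vertex is nonadjacent to at most one other vertex; a 2-plex cluster graph is a graph each of whose connected components is a 2-plex. For $U,W\subseteq V$, $E(U,W)=\{\{u,w\}\in E: u\in U, w\in W\}$. A vertex set $S$ destroys an edge $e$ if $S$ contains an endpoint of $e$. -}

module Defs where

open import Data.Nat using (ℕ)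
open import Data.Bool using (Bool; true; false)
open import Data.Fin using (Fin)
open import Data.Fin.Subset using (Subset; _∈_; _∉_)
open import Data.Product using (Σ; _×_; ∃)
open import Relation.Binary.PropositionalEquality using (_≡_; _≢_)
open import Function.Bundles using (_⇔_)

record Graph (n : ℕ) : Set where
  field
    adj     : Fin n → Fin n → Bool
    adj-sym : ∀ u v → adj u v ≡ adj v u
    adj-irr : ∀ u → adj u u ≡ false

open Graph public

Adj : ∀ {n} → Graph n → Fin n → Fin n → Set
Adj G u v = adj G u v ≡ true

-- Reachability in G - S (the subgraph induced by V \ S):
-- a walk from u to v all of whose vertices lie outside S.
data Reach {n : ℕ} (G : Graph n) (S : Subset n) (u : Fin n) : Fin n → Set where
  here : u ∉ S → Reach G S u u
  step : ∀ {v w} → Reach G S u v → Adj G v w → w ∉ S → Reach G S u w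

-- G - S is a 2-plex cluster graph: every connected component of G - S
-- is a 2-plex, i.e. every vertex u of G - S is nonadjacent to at most
-- one other vertex of its component.
Is2PlexCluster : ∀ {n} → Graph n → Subset n → Set
Is2PlexCluster G S =
  ∀ u v w → Reach G S u v → Reach G S u w →
    u ≢ v → u ≢ w → ¬Adj u v → ¬Adj u w → v ≡ w
  where
    open import Relation.Nullary using (¬_)
    ¬Adj : Fin _ → Fin _ → Set
    ¬Adj a b = ¬ Adj G a b

IsComponent : ∀ {n} → Graph n → Subset n → Subset n → Set
IsComponent G X H = Σ (Fin _) λ c → (c ∉ X) × (∀ v → (v ∈ H) ⇔ Reach G X c v)

DestroysEdges : ∀ {n} → Graph n → Subset n → Subset n → Subset n → Set
DestroysEdges G S' H X =
  ∀ u w → u ∈ H → w ∈ X → Adj G u w → (u ∈ S') ⊎ (w ∈ S')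
  where open import Data.Sum using (_⊎_)

-- (1) |H ∩ M| ≤ |S ∩ H|.  Replace S inside H by H ∩ M:  S' = (S \ H) ∪ (H ∩ M).
--     Then |S'| ≤ |S|, and S' destroys E(H, X) because only vertices of M ∩ H
--     have neighbours in X.  A walk of G - S' never crosses the boundary of H
--     (that would need an edge from H \ M to X), so walks starting in H are
--     walks of G - X and walks starting outside H are walks of G - S; hence
--     every component of G - S' is contained in one of G - X or of G - S.
-- (2) |S ∩ H| < |H ∩ M|.  Then at least two vertices a ≠ b of H \ M survive in
--     G - S, and S itself destroys E(H, X): a surviving edge uw (u ∈ H, w ∈ X)
--     would put w, a, b in one component of G - S (inside the 2-plex H every
--     vertex reaches a and b by short walks), while w is adjacent to neither a
--     nor b — two distinct non-neighbours of w, contradicting the 2-plex property.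
module Submission where

open import Defs
open import Data.Bool using (true)
import Data.Bool as Bool
open import Data.Empty using (⊥-elim)
open import Data.Fin using (Fin; zero; suc)
open import Data.Fin.Properties using (suc-injective)
open import Data.Fin.Subset using (Subset; _∈_; _∉_; _∩_; _∪_; ∁; ∣_∣; inside; outside)
open import Data.Fin.Subset.Properties
  using (_∈?_; x∈p∩q⁺; x∈p∩q⁻; x∈p∪q⁺; x∉p⇒x∈∁p; x∈∁p⇒x∉p; p⊆q⇒∣p∣≤∣q∣)
open import Data.Nat using (ℕ; _≤_; _+_; suc; z≤n; s≤s)
open import Data.Nat.Properties
  using (≤-refl; ≤-trans; ≤-reflexive; ≰⇒>; _≤?_; +-comm; +-suc; +-monoʳ-≤; +-monoˡ-≤;
         +-cancelˡ-≤; n≤1+n; module ≤-Reasoning)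
open import Data.Product using (Σ; _×_; _,_; proj₁; proj₂)
open import Data.Sum using (inj₁; inj₂)
open import Data.Vec using ([]; _∷_; here; there)
open import Function.Bundles using (Equivalence; _⇔_)
open import Relation.Nullary using (¬_; yes; no)
open import Relation.Binary.PropositionalEquality using (_≡_; _≢_; refl; sym; trans; cong)

∣p∣≡∣p∩q∣+∣p∩∁q∣ : ∀ {n} (p q : Subset n) → ∣ p ∣ ≡ ∣ p ∩ q ∣ + ∣ p ∩ ∁ q ∣
∣p∣≡∣p∩q∣+∣p∩∁q∣ []            []            = refl
∣p∣≡∣p∩q∣+∣p∩∁q∣ (inside  ∷ p) (inside  ∷ q) = cong suc (∣p∣≡∣p∩q∣+∣p∩∁q∣ p q)
∣p∣≡∣p∩q∣+∣p∩∁q∣ (inside  ∷ p) (outside ∷ q) =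
  trans (cong suc (∣p∣≡∣p∩q∣+∣p∩∁q∣ p q)) (sym (+-suc (∣ p ∩ q ∣) (∣ p ∩ ∁ q ∣)))
∣p∣≡∣p∩q∣+∣p∩∁q∣ (outside ∷ p) (_       ∷ q) = ∣p∣≡∣p∩q∣+∣p∩∁q∣ p q

∣p∪q∣≤∣p∣+∣q∣ : ∀ {n} (p q : Subset n) → ∣ p ∪ q ∣ ≤ ∣ p ∣ + ∣ q ∣
∣p∪q∣≤∣p∣+∣q∣ []            []            = z≤n
∣p∪q∣≤∣p∣+∣q∣ (inside  ∷ p) (inside  ∷ q) =
  s≤s (≤-trans (∣p∪q∣≤∣p∣+∣q∣ p q) (+-monoʳ-≤ (∣ p ∣) (n≤1+n (∣ q ∣))))
∣p∪q∣≤∣p∣+∣q∣ (inside  ∷ p) (outside ∷ q) = s≤s (∣p∪q∣≤∣p∣+∣q∣ p q)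
∣p∪q∣≤∣p∣+∣q∣ (outside ∷ p) (inside  ∷ q) =
  ≤-trans (s≤s (∣p∪q∣≤∣p∣+∣q∣ p q)) (≤-reflexive (sym (+-suc (∣ p ∣) (∣ q ∣))))
∣p∪q∣≤∣p∣+∣q∣ (outside ∷ p) (outside ∷ q) = ∣p∪q∣≤∣p∣+∣q∣ p q

member : ∀ {n} (p : Subset n) → 1 ≤ ∣ p ∣ → Σ (Fin n) λ a → a ∈ p
member (inside  ∷ p) _    = zero , here
member (outside ∷ p) size with member p size
... | a , a∈p = suc a , there a∈p

two-members : ∀ {n} (p : Subset n) → 2 ≤ ∣ p ∣ →
              Σ (Fin n) λ a → Σ (Fin n) λ b → a ∈ p × b ∈ p × a ≢ b
two-members (inside  ∷ p) (s≤s size) with member p size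
... | b , b∈p = zero , suc b , here , there b∈p , λ ()
two-members (outside ∷ p) size with two-members p size
... | a , b , a∈p , b∈p , a≢b =
  suc a , suc b , there a∈p , there b∈p , λ eq → a≢b (suc-injective eq)

module Walks {n : ℕ} (G : Graph n) where

  adj-sym′ : ∀ {u v} → Adj G u v → Adj G v u
  adj-sym′ {u} {v} uv = trans (sym (adj-sym G u v)) uv

  reach-end : ∀ {S u v} → Reach G S u v → v ∉ S
  reach-end (here v∉S)     = v∉S
  reach-end (step _ _ w∉S) = w∉S

  reach-trans : ∀ {S u v w} → Reach G S u v → Reach G S v w → Reach G S u w
  reach-trans r (here _)         = r
  reach-trans r (step r′ vw w∉S) = step (reach-trans r r′) vw w∉S

  reach-sym : ∀ {S u v} → Reach G S u v → Reach G S v u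
  reach-sym (here u∉S)         = here u∉S
  reach-sym (step r vw w∉S) =
    reach-trans (step (here w∉S) (adj-sym′ vw) (reach-end r)) (reach-sym r)

  reach-lift : ∀ {S T} (P : Fin n → Set) →
               (∀ {v w} → P v → v ∉ S → Adj G v w → w ∉ S → P w) →
               (∀ {v} → P v → v ∉ S → v ∉ T) →
               ∀ {u v} → P u → Reach G S u v → P v × Reach G T u v
  reach-lift P closed avoids Pu (here u∉S) = Pu , here (avoids Pu u∉S)
  reach-lift P closed avoids Pu (step r vw w∉S) with reach-lift P closed avoids Pu r
  ... | Pv , r′ = Pw , step r′ vw (avoids Pw w∉S)
    where Pw = closed Pv (reach-end r) vw w∉S

  cluster-from-local :
    ∀ {S} → (∀ u → Σ (Subset n) λ T →
                     Is2PlexCluster G T × (∀ {v} → Reach G S u v → Reach G T u v)) →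
    Is2PlexCluster G S
  cluster-from-local local u with local u
  ... | T , clusterT , lift = λ v w ruv ruw → clusterT u v w (lift ruv) (lift ruw)

  -- Then u is adjacent to x, or to y with y adjacent
  -- to x (otherwise x or u would have two non-neighbours in the component);
  -- so any S avoiding u, x, y leaves a walk u → x in G - S.
  two-plex-reach : ∀ {S X u x y} → Is2PlexCluster G X →
                   Reach G X u x → Reach G X u y → x ≢ y → u ≢ x → u ≢ y →
                   u ∉ S → x ∉ S → y ∉ S → Reach G S u x
  two-plex-reach {X = X} {u} {x} {y} clusterX rux ruy x≢y u≢x u≢y u∉S x∉S y∉S
    with adj G u x Bool.≟ true
  ... | yes ux = step (here u∉S) ux x∉S
  ... | no ¬ux with adj G u y Bool.≟ true
  ...   | no ¬uy = ⊥-elim (x≢y (clusterX u x y rux ruy u≢x u≢y ¬ux ¬uy))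
  ...   | yes uy with adj G y x Bool.≟ true
  ...     | yes yx = step (step (here u∉S) uy y∉S) yx x∉S
  ...     | no ¬yx = ⊥-elim (u≢y (clusterX x u y rxu rxy (λ eq → u≢x (sym eq)) x≢y
                                   (λ xu → ¬ux (adj-sym′ xu)) (λ xy → ¬yx (adj-sym′ xy))))
    where
    rxu : Reach G X x u
    rxu = reach-sym rux
    rxy : Reach G X x y
    rxy = reach-trans rxu ruy

module Setting {n : ℕ} (G : Graph n) (X M H : Subset n)
               (component : IsComponent G X H)
               (noXNeighbour : ∀ h x → h ∈ H → h ∉ M → x ∈ X → ¬ Adj G h x) where

  open Walks G

  private
    c : Fin n
    c = proj₁ component

    membership : ∀ v → (v ∈ H) ⇔ Reach G X c v
    membership v = proj₂ (proj₂ component) v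

  ∈H⇒reach : ∀ {v} → v ∈ H → Reach G X c v
  ∈H⇒reach = Equivalence.to (membership _)

  ∈H⇒∉X : ∀ {v} → v ∈ H → v ∉ X
  ∈H⇒∉X v∈H = reach-end (∈H⇒reach v∈H)

  H-closed : ∀ {v w} → v ∈ H → Adj G v w → w ∉ X → w ∈ H
  H-closed v∈H vw w∉X = Equivalence.from (membership _) (step (∈H⇒reach v∈H) vw w∉X)

  H-connected : ∀ {u v} → u ∈ H → v ∈ H → Reach G X u v
  H-connected u∈H v∈H = reach-trans (reach-sym (∈H⇒reach u∈H)) (∈H⇒reach v∈H)

  edge-from-H∖M : ∀ {v w} → v ∈ H → v ∉ M → Adj G v w → w ∈ H
  edge-from-H∖M v∈H v∉M vw = H-closed v∈H vw (λ w∈X → noXNeighbour _ _ v∈H v∉M w∈X vw)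

  module Replacement (S : Subset n) where

    S′ : Subset n
    S′ = (S ∩ ∁ H) ∪ (H ∩ M)

    S′-size : ∣ H ∩ M ∣ ≤ ∣ S ∩ H ∣ → ∣ S′ ∣ ≤ ∣ S ∣
    S′-size few = begin
      ∣ S′ ∣                          ≤⟨ ∣p∪q∣≤∣p∣+∣q∣ (S ∩ ∁ H) (H ∩ M) ⟩
      ∣ S ∩ ∁ H ∣ + ∣ H ∩ M ∣         ≤⟨ +-monoʳ-≤ ∣ S ∩ ∁ H ∣ few ⟩
      ∣ S ∩ ∁ H ∣ + ∣ S ∩ H ∣         ≡⟨ +-comm (∣ S ∩ ∁ H ∣) (∣ S ∩ H ∣) ⟩
      ∣ S ∩ H ∣ + ∣ S ∩ ∁ H ∣         ≡⟨ sym (∣p∣≡∣p∩q∣+∣p∩∁q∣ S H) ⟩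
      ∣ S ∣                           ∎
      where open ≤-Reasoning

    ∉S′∩H⇒∉M : ∀ {v} → v ∉ S′ → v ∈ H → v ∉ M
    ∉S′∩H⇒∉M v∉S′ v∈H v∈M = v∉S′ (x∈p∪q⁺ (inj₂ (x∈p∩q⁺ (v∈H , v∈M))))

    ∉S′∖H⇒∉S : ∀ {v} → v ∉ S′ → v ∉ H → v ∉ S
    ∉S′∖H⇒∉S v∉S′ v∉H v∈S = v∉S′ (x∈p∪q⁺ (inj₁ (x∈p∩q⁺ (v∈S , x∉p⇒x∈∁p v∉H))))

    reach-inside : ∀ {u v} → u ∈ H → Reach G S′ u v → Reach G X u v
    reach-inside u∈H r = proj₂ (reach-lift (_∈ H) closed (λ v∈H _ → ∈H⇒∉X v∈H) u∈H r)
      where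
      closed : ∀ {v w} → v ∈ H → v ∉ S′ → Adj G v w → w ∉ S′ → w ∈ H
      closed v∈H v∉S′ vw _ = edge-from-H∖M v∈H (∉S′∩H⇒∉M v∉S′ v∈H) vw

    reach-outside : ∀ {u v} → u ∉ H → Reach G S′ u v → Reach G S u v
    reach-outside u∉H r =
      proj₂ (reach-lift (_∉ H) closed (λ v∉H v∉S′ → ∉S′∖H⇒∉S v∉S′ v∉H) u∉H r)
      where
      closed : ∀ {v w} → v ∉ H → v ∉ S′ → Adj G v w → w ∉ S′ → w ∉ H
      closed v∉H _ vw w∉S′ w∈H =
        v∉H (edge-from-H∖M w∈H (∉S′∩H⇒∉M w∉S′ w∈H) (adj-sym′ vw))

    -- Each component of G - S′ lies in a component of G - X or of G - S.
    S′-cluster : Is2PlexCluster G S → Is2PlexCluster G X → Is2PlexCluster G S′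
    S′-cluster clusterS clusterX = cluster-from-local local
      where
      local : ∀ u → Σ (Subset n) λ T →
                Is2PlexCluster G T × (∀ {v} → Reach G S′ u v → Reach G T u v)
      local u with u ∈? H
      ... | yes u∈H = X , clusterX , reach-inside u∈H
      ... | no  u∉H = S , clusterS , reach-outside u∉H

    -- Only vertices of H ∩ M ⊆ S′ have neighbours in X.
    S′-destroys : DestroysEdges G S′ H X
    S′-destroys u w u∈H w∈X uw with u ∈? M
    ... | yes u∈M = inj₁ (x∈p∪q⁺ (inj₂ (x∈p∩q⁺ (u∈H , u∈M))))
    ... | no  u∉M = ⊥-elim (noXNeighbour u w u∈H u∉M w∈X uw)

  -- For an edge uw with u ∈ H, w ∈ X and u, w ∉ S, the vertex w would reach a
  -- and b in G - S (through u, inside the 2-plex H) but is adjacent to neither.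
  destroys-if-two-survivors :
    ∀ {S} → Is2PlexCluster G S → Is2PlexCluster G X →
    ∀ {a b} → a ∈ H → b ∈ H → a ∉ M → b ∉ M → a ∉ S → b ∉ S → a ≢ b →
    DestroysEdges G S H X
  destroys-if-two-survivors {S} clusterS clusterX {a} {b} a∈H b∈H a∉M b∉M a∉S b∉S a≢b
                            u w u∈H w∈X uw
    with u ∈? S | w ∈? S
  ... | yes u∈S | _       = inj₁ u∈S
  ... | no  _   | yes w∈S = inj₂ w∈S
  ... | no  u∉S | no  w∉S =
    ⊥-elim (a≢b (clusterS w a b (reach-w a≢b a∈H a∉M a∉S b∈H b∉M b∉S)
                                (reach-w (λ eq → a≢b (sym eq)) b∈H b∉M b∉S a∈H a∉M a∉S)
                                (w≢ a∈H) (w≢ b∈H) (¬wadj a∈H a∉M) (¬wadj b∈H b∉M)))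
    where
    w≢ : ∀ {x} → x ∈ H → w ≢ x
    w≢ x∈H refl = ∈H⇒∉X x∈H w∈X
    ¬wadj : ∀ {x} → x ∈ H → x ∉ M → ¬ Adj G w x
    ¬wadj x∈H x∉M wx = noXNeighbour _ w x∈H x∉M w∈X (adj-sym′ wx)
    u≢ : ∀ {x} → x ∈ H → x ∉ M → u ≢ x
    u≢ x∈H x∉M refl = noXNeighbour u w x∈H x∉M w∈X uw
    reach-w : ∀ {x y} → x ≢ y → x ∈ H → x ∉ M → x ∉ S → y ∈ H → y ∉ M → y ∉ S →
              Reach G S w x
    reach-w x≢y x∈H x∉M x∉S y∈H y∉M y∉S =
      reach-trans (step (here w∉S) (adj-sym′ uw) u∉S)
        (two-plex-reach clusterX (H-connected u∈H x∈H) (H-connected u∈H y∈H) x≢y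
                        (u≢ x∈H x∉M) (u≢ y∈H y∉M) u∉S x∉S y∉S)

  two-survivors : ∀ S → suc ∣ S ∩ H ∣ ≤ ∣ H ∩ M ∣ → suc ∣ H ∩ M ∣ ≤ ∣ H ∩ ∁ M ∣ →
                  2 ≤ ∣ (H ∩ ∁ M) ∩ ∁ S ∣
  two-survivors S many card = +-cancelˡ-≤ (∣ S ∩ H ∣) 2 (∣ (H ∩ ∁ M) ∩ ∁ S ∣) (begin
    ∣ S ∩ H ∣ + 2                               ≡⟨ +-comm (∣ S ∩ H ∣) 2 ⟩
    suc (suc ∣ S ∩ H ∣)                         ≤⟨ s≤s many ⟩
    suc ∣ H ∩ M ∣                               ≤⟨ card ⟩
    ∣ H ∩ ∁ M ∣                                 ≡⟨ ∣p∣≡∣p∩q∣+∣p∩∁q∣ (H ∩ ∁ M) S ⟩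
    ∣ (H ∩ ∁ M) ∩ S ∣ + ∣ (H ∩ ∁ M) ∩ ∁ S ∣     ≤⟨ +-monoˡ-≤ _ (p⊆q⇒∣p∣≤∣q∣ H∖M∩S⊆S∩H) ⟩
    ∣ S ∩ H ∣ + ∣ (H ∩ ∁ M) ∩ ∁ S ∣             ∎)
    where
    open ≤-Reasoning
    H∖M∩S⊆S∩H : ∀ {x} → x ∈ (H ∩ ∁ M) ∩ S → x ∈ S ∩ H
    H∖M∩S⊆S∩H x∈ with x∈p∩q⁻ (H ∩ ∁ M) S x∈
    ... | x∈H∖M , x∈S = x∈p∩q⁺ (x∈S , proj₁ (x∈p∩q⁻ H (∁ M) x∈H∖M))

  survivor : ∀ {S x} → x ∈ (H ∩ ∁ M) ∩ ∁ S → x ∈ H × x ∉ M × x ∉ S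
  survivor {S} x∈ with x∈p∩q⁻ (H ∩ ∁ M) (∁ S) x∈
  ... | x∈H∖M , x∈∁S with x∈p∩q⁻ H (∁ M) x∈H∖M
  ...   | x∈H , x∈∁M = x∈H , x∈∁p⇒x∉p x∈∁M , x∈∁p⇒x∉p x∈∁S

  destroys-if-many-survive : ∀ {S} → Is2PlexCluster G S → Is2PlexCluster G X →
                             2 ≤ ∣ (H ∩ ∁ M) ∩ ∁ S ∣ → DestroysEdges G S H X
  destroys-if-many-survive {S} clusterS clusterX many with two-members _ many
  ... | a , b , a∈ , b∈ , a≢b with survivor {S} a∈ | survivor {S} b∈
  ...   | a∈H , a∉M , a∉S | b∈H , b∉M , b∉S =
    destroys-if-two-survivors clusterS clusterX a∈H b∈H a∉M b∉M a∉S b∉S a≢b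

mainTheorem12 : (n : ℕ) (G : Graph n) (S X M H : Subset n) →
    Is2PlexCluster G S → Is2PlexCluster G X →
    IsComponent G X H →
    (∀ h x → h ∈ H → h ∉ M → x ∈ X → ¬ Adj G h x) →
    suc ∣ H ∩ M ∣ ≤ ∣ H ∩ ∁ M ∣ →
    Σ (Subset n) λ S' → (∣ S' ∣ ≤ ∣ S ∣) × Is2PlexCluster G S' × DestroysEdges G S' H X
mainTheorem12 n G S X M H clusterS clusterX component noXNeighbour card
  with ∣ H ∩ M ∣ ≤? ∣ S ∩ H ∣
... | yes few = S′ , S′-size few , S′-cluster clusterS clusterX , S′-destroys
  where open Setting G X M H component noXNeighbour
        open Replacement S
... | no ¬few =
  S , ≤-refl , clusterS ,
  destroys-if-many-survive clusterS clusterX (two-survivors S (≰⇒> ¬few) card)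
  where open Setting G X M H component noXNeighbour
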